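{- For every integer $k\in\mathbb{Z}$, every integer $r\geq 0$ and every integer $n\geq 0$, $$B_{n}^{(k)}(x)=\frac{1}{2^{r}}\sum_{m=0}^{n}\left\{\binom{n}{m}\sum_{j=0}^{r}\binom{r}{j}B_{n-m}^{(k)}(j)\right\}E_{m}^{(r)}(x).$$
   Context: For $k\in\mathbb{Z}$, the polylogarithm is $Li_k(x)=\sum_{m=1}^{\infty}\frac{x^m}{m^k}$. The poly-Bernoulli polynomials $B_n^{(k)}(x)$ are defined by the generating function (an identity of formal power series in $t$) $$\frac{Li_{k}(1-e^{ -t})}{1-e^{ -t}}e^{xt}=\sum_{n=0}^{\infty}B_{n}^{(k)}(x)\frac{t^{n}}{n!}.$$ The Euler polynomials of order $r$ are defined by $\left(\frac{2}{e^t+1}\right)^r e^{xt}=\sum_{n=0}^\infty E_n^{(r)}(x)\frac{t^n}{n!}$. -}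

module Defs where

open import Data.Nat as ℕ using (ℕ; zero; suc; _∸_; _!)
open import Data.Nat.Properties using (_!≢0; m^n≢0)
open import Data.Integer as ℤ using (ℤ; +_; -[1+_])
open import Data.Rational using (ℚ; 0ℚ; 1ℚ; _+_; _*_; -_; _/_; ½)
open import Data.List using (List; []; _∷_; zipWith; map; upTo; foldr)

-- Formal power series over ℚ in the variable t, as coefficient sequences
-- (coefficient of t^n, NOT of t^n/n!).
PS : Set
PS = ℕ → ℚ

sumTo : ℕ → (ℕ → ℚ) → ℚ
sumTo zero    f = f 0
sumTo (suc n) f = sumTo n f + f (suc n)

_^ℚ_ : ℚ → ℕ → ℚ
a ^ℚ zero  = 1ℚ
a ^ℚ suc n = a * (a ^ℚ n)

ℕ→ℚ : ℕ → ℚ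
ℕ→ℚ n = (+ n) / 1

oneS : PS
oneS zero    = 1ℚ
oneS (suc _) = 0ℚ

_⊛_ : PS → PS → PS
(f ⊛ g) n = sumTo n (λ i → f i * g (n ∸ i))

powS : PS → ℕ → PS
powS f zero    = oneS
powS f (suc m) = f ⊛ powS f m

expS : ℚ → PS
expS a n = (a ^ℚ n) * invFact
  where
  invFact : ℚ
  invFact = let instance _ = n !≢0 in (+ 1) / (n !)

-- multiplicative inverse of a series with constant term 1:
-- b_0 = 1, b_n = - Σ_{i=1}^{n} a_i b_{n-i}.
-- invList a n = [b_n , b_{n-1} , … , b_0]
invList : PS → ℕ → List ℚ
invList a zero    = 1ℚ ∷ []
invList a (suc n) = bnew ∷ prev
  where
  prev : List ℚ
  prev = invList a n
  bnew : ℚ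
  bnew = - foldr _+_ 0ℚ (zipWith _*_ (map (λ i → a (suc i)) (upTo (suc n))) prev)

head0 : List ℚ → ℚ
head0 []      = 0ℚ
head0 (b ∷ _) = b

inv1 : PS → PS
inv1 a n = head0 (invList a n)

oneMinusExpNeg : PS
oneMinusExpNeg n = oneS n + - expS (- 1ℚ) n

-- 1 / m^k for k ∈ ℤ, m ≥ 1 ; here m = suc m'
invPowZ : ℕ → ℤ → ℚ
invPowZ m' (+ a)     = let instance _ = m^n≢0 (suc m') a in (+ 1) / (suc m' ℕ.^ a)
invPowZ m' -[1+ a ]  = ℕ→ℚ (suc m' ℕ.^ suc a)

-- Li_k(y)/y = Σ_{m≥0} y^m / (m+1)^k, evaluated at y = 1 - e^{-t}.
-- Since 1 - e^{-t} has zero constant term, (1-e^{-t})^m has no t^n term for m > n,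
-- so the coefficient of t^n is the finite sum over m = 0..n.
polyBernGen : ℤ → PS
polyBernGen k n = sumTo n (λ m → invPowZ m k * powS oneMinusExpNeg m n)

polyBernoulli : ℤ → ℕ → ℚ → ℚ
polyBernoulli k n x = ℕ→ℚ (n !) * (polyBernGen k ⊛ expS x) n

halfExpPlusOne : PS
halfExpPlusOne n = (expS 1ℚ n + oneS n) * ½

eulerPoly : ℕ → ℕ → ℚ → ℚ
eulerPoly r n x = ℕ→ℚ (n !) * (powS (inv1 halfExpPlusOne) r ⊛ expS x) n

-- Let G be the generating function of the B_n^(k) and h = (e^t + 1)/2.  The series h^r and
-- (2/(e^t + 1))^r are mutually inverse, so
--   G e^(xt) = ((2/(e^t + 1))^r e^(xt)) · (G h^r).
-- The first factor generates the E_m^(r)(x).  Expanding h^r = 2^(-r) Σ_j C(r,j) e^(jt) shows that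
-- the second generates 2^(-r) Σ_j C(r,j) B_p^(k)(j), and comparing coefficients of t^n/n! gives the
-- binomial convolution of the two.

module Submission where

open import Defs
open import Algebra.Bundles using (CommutativeMonoid)
open import Algebra.Definitions using (Congruent₂)
import Algebra.Properties.CommutativeSemigroup as CommSemigroupProperties
open import Algebra.Structures using (IsCommutativeMonoid)
open import Data.Integer using (ℤ; +_)
import Data.Integer as ℤ
import Data.Integer.Properties as ℤₚ
open import Data.List using (_∷_; applyUpTo; foldr; zipWith)
open import Data.List.Properties using (map-applyUpTo)
open import Data.Maybe using (nothing)
open import Data.Nat using (ℕ; zero; suc; _∸_; _!; _≤_; z≤n; NonZero)
import Data.Nat as ℕ
open import Data.Nat.Combinatorics
  using (_C_; nCk+nC[k+1]≡[n+1]C[k+1]; k>n⇒nCk≡0; nCk≡n!/k![n-k]!; k![n∸k]!∣n!)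
open import Data.Nat.DivMod using (m/n*n≡m)
import Data.Nat.Properties as ℕₚ
open import Data.Product using (_,_)
open import Data.Rational using (ℚ; _+_; _*_; -_; 0ℚ; 1ℚ; ½; _/_; toℚᵘ)
import Data.Rational.Properties as ℚ
import Data.Rational.Unnormalised as ℚᵘ
import Data.Rational.Unnormalised.Properties as ℚᵘₚ
open import Level using (0ℓ)
open import Relation.Binary.PropositionalEquality
  using (_≡_; refl; sym; trans; cong; cong₂; module ≡-Reasoning)
import Relation.Binary.Reasoning.Setoid as SetoidReasoning
open import Relation.Binary.Structures using (IsEquivalence)
open import Tactic.RingSolver using (solve-∀)
open import Tactic.RingSolver.Core.AlmostCommutativeRing
  using (AlmostCommutativeRing; fromCommutativeRing)

ℚ-ring : AlmostCommutativeRing 0ℓ 0ℓ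
ℚ-ring = fromCommutativeRing ℚ.+-*-commutativeRing (λ _ → nothing)

open CommSemigroupProperties (CommutativeMonoid.commutativeSemigroup ℚ.+-0-commutativeMonoid)
  using () renaming (interchange to +-interchange)
open CommSemigroupProperties (CommutativeMonoid.commutativeSemigroup ℚ.*-1-commutativeMonoid)
  using () renaming (x∙yz≈y∙xz to x*[y*z]≡y*[x*z])

toℚᵘ-ℕ→ℚ : ∀ n → toℚᵘ (ℕ→ℚ n) ℚᵘ.≃ ℚᵘ.mkℚᵘ (+ n) 0
toℚᵘ-ℕ→ℚ n = ℚ.toℚᵘ-fromℚᵘ (ℚᵘ.mkℚᵘ (+ n) 0)

ℕ→ℚ-+ : ∀ m n → ℕ→ℚ (m ℕ.+ n) ≡ ℕ→ℚ m + ℕ→ℚ n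
ℕ→ℚ-+ m n = ℚ.toℚᵘ-injective (begin
  toℚᵘ (ℕ→ℚ (m ℕ.+ n))                    ≈⟨ toℚᵘ-ℕ→ℚ (m ℕ.+ n) ⟩
  ℚᵘ.mkℚᵘ (+ (m ℕ.+ n)) 0                 ≈⟨ ℚᵘ.*≡* numerators ⟩
  ℚᵘ.mkℚᵘ (+ m) 0 ℚᵘ.+ ℚᵘ.mkℚᵘ (+ n) 0    ≈⟨ ℚᵘₚ.+-cong (toℚᵘ-ℕ→ℚ m) (toℚᵘ-ℕ→ℚ n) ⟨
  toℚᵘ (ℕ→ℚ m) ℚᵘ.+ toℚᵘ (ℕ→ℚ n)          ≈⟨ ℚ.toℚᵘ-homo-+ (ℕ→ℚ m) (ℕ→ℚ n) ⟨
  toℚᵘ (ℕ→ℚ m + ℕ→ℚ n)                    ∎)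
  where
  open ℚᵘₚ.≃-Reasoning
  numerators : + (m ℕ.+ n) ℤ.* + 1 ≡ (+ m ℤ.* + 1 ℤ.+ + n ℤ.* + 1) ℤ.* + 1
  numerators = trans (ℤₚ.*-identityʳ _) (trans (ℤₚ.pos-+ m n) (sym (trans (ℤₚ.*-identityʳ _)
    (cong₂ ℤ._+_ (ℤₚ.*-identityʳ (+ m)) (ℤₚ.*-identityʳ (+ n))))))

ℕ→ℚ-* : ∀ m n → ℕ→ℚ (m ℕ.* n) ≡ ℕ→ℚ m * ℕ→ℚ n
ℕ→ℚ-* m n = ℚ.toℚᵘ-injective (begin
  toℚᵘ (ℕ→ℚ (m ℕ.* n))                    ≈⟨ toℚᵘ-ℕ→ℚ (m ℕ.* n) ⟩
  ℚᵘ.mkℚᵘ (+ (m ℕ.* n)) 0                 ≈⟨ ℚᵘ.*≡* (cong (ℤ._* + 1) (ℤₚ.pos-* m n)) ⟩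
  ℚᵘ.mkℚᵘ (+ m) 0 ℚᵘ.* ℚᵘ.mkℚᵘ (+ n) 0    ≈⟨ ℚᵘₚ.*-cong (toℚᵘ-ℕ→ℚ m) (toℚᵘ-ℕ→ℚ n) ⟨
  toℚᵘ (ℕ→ℚ m) ℚᵘ.* toℚᵘ (ℕ→ℚ n)          ≈⟨ ℚ.toℚᵘ-homo-* (ℕ→ℚ m) (ℕ→ℚ n) ⟨
  toℚᵘ (ℕ→ℚ m * ℕ→ℚ n)                    ∎)
  where open ℚᵘₚ.≃-Reasoning

ℕ→ℚ-*-inverse : ∀ n .{{_ : NonZero n}} → ℕ→ℚ n * ((+ 1) / n) ≡ 1ℚ
ℕ→ℚ-*-inverse (suc m) = ℚ.toℚᵘ-injective (begin
  toℚᵘ (ℕ→ℚ (suc m) * ((+ 1) / suc m))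
    ≈⟨ ℚ.toℚᵘ-homo-* (ℕ→ℚ (suc m)) ((+ 1) / suc m) ⟩
  toℚᵘ (ℕ→ℚ (suc m)) ℚᵘ.* toℚᵘ ((+ 1) / suc m)
    ≈⟨ ℚᵘₚ.*-cong (toℚᵘ-ℕ→ℚ (suc m)) (ℚ.toℚᵘ-fromℚᵘ (ℚᵘ.mkℚᵘ (+ 1) m)) ⟩
  ℚᵘ.mkℚᵘ (+ suc m) 0 ℚᵘ.* ℚᵘ.mkℚᵘ (+ 1) m
    ≈⟨ ℚᵘ.*≡* numerators ⟩
  toℚᵘ 1ℚ ∎)
  where
  open ℚᵘₚ.≃-Reasoning
  numerators : (+ suc m ℤ.* + 1) ℤ.* + 1 ≡ + 1 ℤ.* + (1 ℕ.* suc m)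
  numerators = trans (ℤₚ.*-identityʳ _) (trans (ℤₚ.*-identityʳ _)
    (sym (trans (ℤₚ.*-identityˡ _) (cong +_ (ℕₚ.*-identityˡ (suc m))))))

*-cancelˡ-ℕ→ℚ : ∀ n .{{_ : NonZero n}} {x y} → ℕ→ℚ n * x ≡ ℕ→ℚ n * y → x ≡ y
*-cancelˡ-ℕ→ℚ n {x} {y} nx≡ny = begin
  x                        ≡⟨ ℚ.*-identityˡ x ⟨
  1ℚ * x                   ≡⟨ cong (_* x) inverseˡ ⟨
  ((+ 1) / n * ℕ→ℚ n) * x  ≡⟨ ℚ.*-assoc ((+ 1) / n) (ℕ→ℚ n) x ⟩
  (+ 1) / n * (ℕ→ℚ n * x)  ≡⟨ cong ((+ 1) / n *_) nx≡ny ⟩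
  (+ 1) / n * (ℕ→ℚ n * y)  ≡⟨ ℚ.*-assoc ((+ 1) / n) (ℕ→ℚ n) y ⟨
  ((+ 1) / n * ℕ→ℚ n) * y  ≡⟨ cong (_* y) inverseˡ ⟩
  1ℚ * y                   ≡⟨ ℚ.*-identityˡ y ⟩
  y                        ∎
  where
  open ≡-Reasoning
  inverseˡ : (+ 1) / n * ℕ→ℚ n ≡ 1ℚ
  inverseˡ = trans (ℚ.*-comm ((+ 1) / n) (ℕ→ℚ n)) (ℕ→ℚ-*-inverse n)

-- expS a n unfolds definitionally to a ^ℚ n * n !⁻¹.
_!⁻¹ : ℕ → ℚ
n !⁻¹ = let instance _ = n ℕₚ.!≢0 in (+ 1) / (n !)

!-*-!⁻¹ : ∀ n → ℕ→ℚ (n !) * n !⁻¹ ≡ 1ℚ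
!-*-!⁻¹ n = ℕ→ℚ-*-inverse (n !) {{n ℕₚ.!≢0}}

suc-*-suc!⁻¹ : ∀ n → ℕ→ℚ (suc n) * suc n !⁻¹ ≡ n !⁻¹
suc-*-suc!⁻¹ n = *-cancelˡ-ℕ→ℚ (n !) {{n ℕₚ.!≢0}} (begin
  ℕ→ℚ (n !) * (ℕ→ℚ (suc n) * suc n !⁻¹) ≡⟨ x*[y*z]≡y*[x*z] (ℕ→ℚ (n !)) (ℕ→ℚ (suc n)) (suc n !⁻¹) ⟩
  ℕ→ℚ (suc n) * (ℕ→ℚ (n !) * suc n !⁻¹) ≡⟨ ℚ.*-assoc (ℕ→ℚ (suc n)) (ℕ→ℚ (n !)) (suc n !⁻¹) ⟨
  (ℕ→ℚ (suc n) * ℕ→ℚ (n !)) * suc n !⁻¹ ≡⟨ cong (_* suc n !⁻¹) (ℕ→ℚ-* (suc n) (n !)) ⟨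
  ℕ→ℚ (suc n !) * suc n !⁻¹             ≡⟨ !-*-!⁻¹ (suc n) ⟩
  1ℚ                                     ≡⟨ !-*-!⁻¹ n ⟨
  ℕ→ℚ (n !) * n !⁻¹                     ∎)
  where open ≡-Reasoning

sumTo-cong : ∀ n {f g : ℕ → ℚ} → (∀ i → i ≤ n → f i ≡ g i) → sumTo n f ≡ sumTo n g
sumTo-cong zero    eq = eq 0 z≤n
sumTo-cong (suc n) eq =
  cong₂ _+_ (sumTo-cong n (λ i i≤n → eq i (ℕₚ.m≤n⇒m≤1+n i≤n))) (eq (suc n) ℕₚ.≤-refl)

sumTo-ext : ∀ n {f g : ℕ → ℚ} → (∀ i → f i ≡ g i) → sumTo n f ≡ sumTo n g
sumTo-ext n eq = sumTo-cong n (λ i _ → eq i)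

sumTo-0 : ∀ n (f : ℕ → ℚ) → (∀ i → f i ≡ 0ℚ) → sumTo n f ≡ 0ℚ
sumTo-0 zero    f f≡0 = f≡0 0
sumTo-0 (suc n) f f≡0 = cong₂ _+_ (sumTo-0 n f f≡0) (f≡0 (suc n))

sumTo-distrib-+ : ∀ n (f g : ℕ → ℚ) → sumTo n (λ i → f i + g i) ≡ sumTo n f + sumTo n g
sumTo-distrib-+ zero    f g = refl
sumTo-distrib-+ (suc n) f g = trans (cong (_+ (f (suc n) + g (suc n))) (sumTo-distrib-+ n f g))
  (+-interchange (sumTo n f) (sumTo n g) (f (suc n)) (g (suc n)))

*-distribˡ-sumTo : ∀ n c (f : ℕ → ℚ) → c * sumTo n f ≡ sumTo n (λ i → c * f i)
*-distribˡ-sumTo zero    c f = refl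
*-distribˡ-sumTo (suc n) c f = trans (ℚ.*-distribˡ-+ c (sumTo n f) (f (suc n)))
  (cong (_+ c * f (suc n)) (*-distribˡ-sumTo n c f))

*-distribʳ-sumTo : ∀ n c (f : ℕ → ℚ) → sumTo n f * c ≡ sumTo n (λ i → f i * c)
*-distribʳ-sumTo n c f = trans (ℚ.*-comm (sumTo n f) c)
  (trans (*-distribˡ-sumTo n c f) (sumTo-ext n (λ i → ℚ.*-comm c (f i))))

sumTo-suc : ∀ n (f : ℕ → ℚ) → sumTo (suc n) f ≡ f 0 + sumTo n (λ i → f (suc i))
sumTo-suc zero    f = refl
sumTo-suc (suc n) f = trans (cong (_+ f (suc (suc n))) (sumTo-suc n f))
  (ℚ.+-assoc (f 0) (sumTo n (λ i → f (suc i))) (f (suc (suc n))))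

sumTo-reverse : ∀ n (f : ℕ → ℚ) → sumTo n f ≡ sumTo n (λ i → f (n ∸ i))
sumTo-reverse zero    f = refl
sumTo-reverse (suc n) f = begin
  sumTo n f + f (suc n)                 ≡⟨ cong (_+ f (suc n)) (sumTo-reverse n f) ⟩
  sumTo n (λ i → f (n ∸ i)) + f (suc n) ≡⟨ ℚ.+-comm (sumTo n (λ i → f (n ∸ i))) (f (suc n)) ⟩
  f (suc n) + sumTo n (λ i → f (n ∸ i)) ≡⟨ sumTo-suc n (λ i → f (suc n ∸ i)) ⟨
  sumTo (suc n) (λ i → f (suc n ∸ i))   ∎
  where open ≡-Reasoning

sumTo-comm : ∀ n m (F : ℕ → ℕ → ℚ) →
  sumTo n (λ i → sumTo m (F i)) ≡ sumTo m (λ j → sumTo n (λ i → F i j))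
sumTo-comm n zero    F = refl
sumTo-comm n (suc m) F = trans (sumTo-distrib-+ n (λ i → sumTo m (F i)) (λ i → F i (suc m)))
  (cong (_+ sumTo n (λ i → F i (suc m))) (sumTo-comm n m F))

sumTo-triangle : ∀ n (A : ℕ → ℕ → ℚ) →
  sumTo n (λ s → sumTo s (λ i → A i s)) ≡ sumTo n (λ i → sumTo (n ∸ i) (λ j → A i (i ℕ.+ j)))
sumTo-triangle zero    A = refl
sumTo-triangle (suc n) A = begin
  sumTo n (λ s → sumTo s (λ i → A i s)) + (column n + A (suc n) (suc n))
    ≡⟨ cong (_+ (column n + A (suc n) (suc n))) (sumTo-triangle n A) ⟩
  sumTo n (row n) + (column n + A (suc n) (suc n))
    ≡⟨ ℚ.+-assoc (sumTo n (row n)) (column n) (A (suc n) (suc n)) ⟨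
  (sumTo n (row n) + column n) + A (suc n) (suc n)
    ≡⟨ cong (_+ A (suc n) (suc n)) (sumTo-distrib-+ n (row n) (λ i → A i (suc n))) ⟨
  sumTo n (λ i → row n i + A i (suc n)) + A (suc n) (suc n)
    ≡⟨ cong₂ _+_ (sumTo-cong n extend-row) last-row ⟩
  sumTo n (row (suc n)) + row (suc n) (suc n) ∎
  where
  open ≡-Reasoning
  row : ℕ → ℕ → ℚ
  row l i = sumTo (l ∸ i) (λ j → A i (i ℕ.+ j))
  column : ℕ → ℚ
  column l = sumTo l (λ i → A i (suc l))
  extend-row : ∀ i → i ≤ n → row n i + A i (suc n) ≡ row (suc n) i
  extend-row i i≤n = sym (trans (cong (λ l → sumTo l (λ j → A i (i ℕ.+ j))) (ℕₚ.+-∸-assoc 1 i≤n))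
    (cong (λ l → row n i + A i l) (trans (ℕₚ.+-suc i (n ∸ i)) (cong suc (ℕₚ.m+[n∸m]≡n i≤n)))))
  last-row : A (suc n) (suc n) ≡ row (suc n) (suc n)
  last-row = sym (trans (cong (λ l → sumTo l (λ j → A (suc n) (suc n ℕ.+ j))) (ℕₚ.n∸n≡0 n))
    (cong (A (suc n)) (ℕₚ.+-identityʳ (suc n))))

sumTo-pascal : ∀ r (g : ℕ → ℚ) →
  sumTo (suc r) (λ j → ℕ→ℚ (suc r C j) * g j)
    ≡ sumTo r (λ j → ℕ→ℚ (r C j) * g (suc j)) + sumTo r (λ j → ℕ→ℚ (r C j) * g j)
sumTo-pascal r g = begin
  sumTo (suc r) (λ j → ℕ→ℚ (suc r C j) * g j)
    ≡⟨ sumTo-suc r (λ j → ℕ→ℚ (suc r C j) * g j) ⟩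
  g₀ + sumTo r (λ j → ℕ→ℚ (suc r C suc j) * g (suc j))
    ≡⟨ cong (_+_ g₀) (trans (sumTo-ext r split) (sumTo-distrib-+ r
         (λ j → ℕ→ℚ (r C j) * g (suc j)) (λ j → ℕ→ℚ (r C suc j) * g (suc j)))) ⟩
  g₀ + (shifted + upper)
    ≡⟨ x+[y+z]≡y+[x+z] g₀ shifted upper ⟩
  shifted + (g₀ + upper)
    ≡⟨ cong (_+_ shifted) (sumTo-suc r (λ j → ℕ→ℚ (r C j) * g j)) ⟨
  shifted + sumTo (suc r) (λ j → ℕ→ℚ (r C j) * g j)
    ≡⟨ cong (_+_ shifted) (cong (_+_ (sumTo r (λ j → ℕ→ℚ (r C j) * g j))) top-vanishes) ⟩
  shifted + (sumTo r (λ j → ℕ→ℚ (r C j) * g j) + 0ℚ)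
    ≡⟨ cong (_+_ shifted) (ℚ.+-identityʳ (sumTo r (λ j → ℕ→ℚ (r C j) * g j))) ⟩
  shifted + sumTo r (λ j → ℕ→ℚ (r C j) * g j) ∎
  where
  open ≡-Reasoning
  g₀ = ℕ→ℚ (r C 0) * g 0
  shifted = sumTo r (λ j → ℕ→ℚ (r C j) * g (suc j))
  upper = sumTo r (λ j → ℕ→ℚ (r C suc j) * g (suc j))
  x+[y+z]≡y+[x+z] : ∀ x y z → x + (y + z) ≡ y + (x + z)
  x+[y+z]≡y+[x+z] = solve-∀ ℚ-ring
  split : ∀ j → ℕ→ℚ (suc r C suc j) * g (suc j)
              ≡ ℕ→ℚ (r C j) * g (suc j) + ℕ→ℚ (r C suc j) * g (suc j)
  split j = trans (cong (λ c → ℕ→ℚ c * g (suc j)) (sym (nCk+nC[k+1]≡[n+1]C[k+1] r j)))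
    (trans (cong (_* g (suc j)) (ℕ→ℚ-+ (r C j) (r C suc j)))
           (ℚ.*-distribʳ-+ (g (suc j)) (ℕ→ℚ (r C j)) (ℕ→ℚ (r C suc j))))
  top-vanishes : ℕ→ℚ (r C suc r) * g (suc r) ≡ 0ℚ
  top-vanishes =
    trans (cong (λ c → ℕ→ℚ c * g (suc r)) (k>n⇒nCk≡0 (ℕₚ.n<1+n r))) (ℚ.*-zeroˡ (g (suc r)))

-- Formal power series under the Cauchy product

infix 4 _≋_
_≋_ : PS → PS → Set
f ≋ g = ∀ n → f n ≡ g n

≋-isEquivalence : IsEquivalence _≋_
≋-isEquivalence = record
  { refl  = λ _ → refl
  ; sym   = λ f≋g n → sym (f≋g n)
  ; trans = λ f≋g g≋h n → trans (f≋g n) (g≋h n)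
  }

⊛-cong : Congruent₂ _≋_ _⊛_
⊛-cong f≋f′ g≋g′ n = sumTo-ext n (λ i → cong₂ _*_ (f≋f′ i) (g≋g′ (n ∸ i)))

⊛-congˡ : ∀ f {g g′} → g ≋ g′ → (f ⊛ g) ≋ (f ⊛ g′)
⊛-congˡ f {g} {g′} = ⊛-cong {f} {f} {g} {g′} (λ _ → refl)

⊛-congʳ : ∀ g {f f′} → f ≋ f′ → (f ⊛ g) ≋ (f′ ⊛ g)
⊛-congʳ g {f} {f′} f≋f′ = ⊛-cong {f} {f′} {g} {g} f≋f′ (λ _ → refl)

⊛-comm : ∀ f g → (f ⊛ g) ≋ (g ⊛ f)
⊛-comm f g n = trans (sumTo-reverse n (λ i → f i * g (n ∸ i))) (sumTo-cong n (λ i i≤n →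
  trans (ℚ.*-comm (f (n ∸ i)) (g (n ∸ (n ∸ i)))) (cong (λ j → g j * f (n ∸ i)) (ℕₚ.m∸[m∸n]≡n i≤n))))

⊛-assoc : ∀ f g h → ((f ⊛ g) ⊛ h) ≋ (f ⊛ (g ⊛ h))
⊛-assoc f g h n = begin
  sumTo n (λ s → sumTo s (λ i → f i * g (s ∸ i)) * h (n ∸ s))
    ≡⟨ sumTo-ext n (λ s → *-distribʳ-sumTo s (h (n ∸ s)) (λ i → f i * g (s ∸ i))) ⟩
  sumTo n (λ s → sumTo s (λ i → f i * g (s ∸ i) * h (n ∸ s)))
    ≡⟨ sumTo-triangle n (λ i s → f i * g (s ∸ i) * h (n ∸ s)) ⟩
  sumTo n (λ i → sumTo (n ∸ i) (λ j → f i * g (i ℕ.+ j ∸ i) * h (n ∸ (i ℕ.+ j))))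
    ≡⟨ sumTo-ext n (λ i → sumTo-ext (n ∸ i) (λ j →
         trans (cong₂ (λ u v → f i * g u * h v) (ℕₚ.m+n∸m≡n i j) (sym (ℕₚ.∸-+-assoc n i j)))
               (ℚ.*-assoc (f i) (g j) (h (n ∸ i ∸ j))))) ⟩
  sumTo n (λ i → sumTo (n ∸ i) (λ j → f i * (g j * h (n ∸ i ∸ j))))
    ≡⟨ sumTo-ext n (λ i → *-distribˡ-sumTo (n ∸ i) (f i) (λ j → g j * h (n ∸ i ∸ j))) ⟨
  sumTo n (λ i → f i * sumTo (n ∸ i) (λ j → g j * h (n ∸ i ∸ j))) ∎
  where open ≡-Reasoning

⊛-identityˡ : ∀ f → (oneS ⊛ f) ≋ f
⊛-identityˡ f zero    = ℚ.*-identityˡ (f 0)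
⊛-identityˡ f (suc n) = begin
  sumTo (suc n) (λ i → oneS i * f (suc n ∸ i))
    ≡⟨ sumTo-suc n (λ i → oneS i * f (suc n ∸ i)) ⟩
  1ℚ * f (suc n) + sumTo n (λ i → 0ℚ * f (n ∸ i))
    ≡⟨ cong₂ _+_ (ℚ.*-identityˡ (f (suc n))) (sumTo-0 n _ (λ i → ℚ.*-zeroˡ (f (n ∸ i)))) ⟩
  f (suc n) + 0ℚ
    ≡⟨ ℚ.+-identityʳ (f (suc n)) ⟩
  f (suc n) ∎
  where open ≡-Reasoning

⊛-identityʳ : ∀ f → (f ⊛ oneS) ≋ f
⊛-identityʳ f n = trans (⊛-comm f oneS n) (⊛-identityˡ f n)

⊛-isCommutativeMonoid : IsCommutativeMonoid _≋_ _⊛_ oneS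
⊛-isCommutativeMonoid = record
  { isMonoid = record
    { isSemigroup = record
      { isMagma = record { isEquivalence = ≋-isEquivalence ; ∙-cong = ⊛-cong }
      ; assoc   = ⊛-assoc
      }
    ; identity = ⊛-identityˡ , ⊛-identityʳ
    }
  ; comm = ⊛-comm
  }

⊛-commutativeMonoid : CommutativeMonoid 0ℓ 0ℓ
⊛-commutativeMonoid = record { isCommutativeMonoid = ⊛-isCommutativeMonoid }

module ≋-Reasoning = SetoidReasoning (CommutativeMonoid.setoid ⊛-commutativeMonoid)
open CommSemigroupProperties (CommutativeMonoid.commutativeSemigroup ⊛-commutativeMonoid)
  using () renaming (interchange to ⊛-interchange)

powS-inverse : ∀ {h b} → (h ⊛ b) ≋ oneS → ∀ r → (powS h r ⊛ powS b r) ≋ oneS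
powS-inverse hb zero            = ⊛-identityˡ oneS
powS-inverse {h} {b} hb (suc r) = begin
  (h ⊛ powS h r) ⊛ (b ⊛ powS b r)  ≈⟨ ⊛-interchange h (powS h r) b (powS b r) ⟩
  (h ⊛ b) ⊛ (powS h r ⊛ powS b r)  ≈⟨ ⊛-cong hb (powS-inverse hb r) ⟩
  oneS ⊛ oneS                      ≈⟨ ⊛-identityˡ oneS ⟩
  oneS                             ∎
  where open ≋-Reasoning

⊛-insert-inverse : ∀ {h p} → (h ⊛ p) ≋ oneS → ∀ f e → (f ⊛ e) ≋ ((p ⊛ e) ⊛ (f ⊛ h))
⊛-insert-inverse {h} {p} hp f e = begin
  f ⊛ e                ≈⟨ ⊛-identityʳ (f ⊛ e) ⟨
  (f ⊛ e) ⊛ oneS       ≈⟨ ⊛-congˡ (f ⊛ e) hp ⟨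
  (f ⊛ e) ⊛ (h ⊛ p)    ≈⟨ ⊛-cong (⊛-comm f e) (⊛-comm h p) ⟩
  (e ⊛ f) ⊛ (p ⊛ h)    ≈⟨ ⊛-interchange e f p h ⟩
  (e ⊛ p) ⊛ (f ⊛ h)    ≈⟨ ⊛-congʳ (f ⊛ h) (⊛-comm e p) ⟩
  (p ⊛ e) ⊛ (f ⊛ h)    ∎
  where open ≋-Reasoning

⊛-sumʳ : ∀ f r (c : ℕ → ℚ) (g : ℕ → PS) →
  (f ⊛ (λ m → sumTo r (λ j → c j * g j m))) ≋ (λ m → sumTo r (λ j → c j * (f ⊛ g j) m))
⊛-sumʳ f r c g n = begin
  sumTo n (λ i → f i * sumTo r (λ j → c j * g j (n ∸ i)))
    ≡⟨ sumTo-ext n (λ i → *-distribˡ-sumTo r (f i) (λ j → c j * g j (n ∸ i))) ⟩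
  sumTo n (λ i → sumTo r (λ j → f i * (c j * g j (n ∸ i))))
    ≡⟨ sumTo-comm n r (λ i j → f i * (c j * g j (n ∸ i))) ⟩
  sumTo r (λ j → sumTo n (λ i → f i * (c j * g j (n ∸ i))))
    ≡⟨ sumTo-ext r (λ j → trans (sumTo-ext n (λ i → x*[y*z]≡y*[x*z] (f i) (c j) (g j (n ∸ i))))
                                 (sym (*-distribˡ-sumTo n (c j) (λ i → f i * g j (n ∸ i))))) ⟩
  sumTo r (λ j → c j * (f ⊛ g j) n) ∎
  where open ≡-Reasoning

⊛-scaleʳ : ∀ f g c → (f ⊛ (λ m → c * g m)) ≋ (λ m → c * (f ⊛ g) m)
⊛-scaleʳ f g c = ⊛-sumʳ f 0 (λ _ → c) (λ _ → g)

⊛-scaleˡ : ∀ f g c → ((λ m → c * f m) ⊛ g) ≋ (λ m → c * (f ⊛ g) m)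
⊛-scaleˡ f g c n = trans (⊛-comm (λ m → c * f m) g n)
  (trans (⊛-scaleʳ g f c n) (cong (c *_) (⊛-comm g f n)))

foldr-zipWith-applyUpTo : ∀ m (a b : ℕ → ℚ) →
  foldr _+_ 0ℚ (zipWith _*_ (applyUpTo a (suc m)) (applyUpTo b (suc m))) ≡ sumTo m (λ i → a i * b i)
foldr-zipWith-applyUpTo zero    a b = ℚ.+-identityʳ (a 0 * b 0)
foldr-zipWith-applyUpTo (suc m) a b =
  trans (cong (_+_ (a 0 * b 0)) (foldr-zipWith-applyUpTo m (λ i → a (suc i)) (λ i → b (suc i))))
        (sym (sumTo-suc m (λ i → a i * b i)))

invList-applyUpTo : ∀ a n → invList a n ≡ applyUpTo (λ i → inv1 a (n ∸ i)) (suc n)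
invList-applyUpTo a zero    = refl
invList-applyUpTo a (suc n) = cong (inv1 a (suc n) ∷_) (invList-applyUpTo a n)

inv1-suc : ∀ a n → inv1 a (suc n) ≡ - sumTo n (λ i → a (suc i) * inv1 a (n ∸ i))
inv1-suc a n = cong -_ (trans
  (cong₂ (λ as bs → foldr _+_ 0ℚ (zipWith _*_ as bs))
         (map-applyUpTo (λ i → i) (λ i → a (suc i)) (suc n)) (invList-applyUpTo a n))
  (foldr-zipWith-applyUpTo n (λ i → a (suc i)) (λ i → inv1 a (n ∸ i))))

⊛-inv1 : ∀ a → a 0 ≡ 1ℚ → (a ⊛ inv1 a) ≋ oneS
⊛-inv1 a a₀≡1 zero    = cong (_* 1ℚ) a₀≡1
⊛-inv1 a a₀≡1 (suc n) = begin
  sumTo (suc n) (λ i → a i * inv1 a (suc n ∸ i))  ≡⟨ sumTo-suc n (λ i → a i * inv1 a (suc n ∸ i)) ⟩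
  a 0 * inv1 a (suc n) + tail                     ≡⟨ cong (λ x → x * inv1 a (suc n) + tail) a₀≡1 ⟩
  1ℚ * inv1 a (suc n) + tail                      ≡⟨ cong (_+ tail) (ℚ.*-identityˡ (inv1 a (suc n))) ⟩
  inv1 a (suc n) + tail                           ≡⟨ cong (_+ tail) (inv1-suc a n) ⟩
  - tail + tail                                   ≡⟨ ℚ.+-inverseˡ tail ⟩
  0ℚ                                              ∎
  where
  open ≡-Reasoning
  tail = sumTo n (λ i → a (suc i) * inv1 a (n ∸ i))

derivS : PS → PS
derivS f n = ℕ→ℚ (suc n) * f (suc n)

-- The coefficient (n+1) of t^(n+1) splits as i + (n+1-i) in the i-th term of the product.
derivS-⊛ : ∀ f g → derivS (f ⊛ g) ≋ (λ n → (derivS f ⊛ g) n + (f ⊛ derivS g) n)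
derivS-⊛ f g n = begin
  ℕ→ℚ (suc n) * sumTo (suc n) term
    ≡⟨ *-distribˡ-sumTo (suc n) (ℕ→ℚ (suc n)) term ⟩
  sumTo (suc n) (λ i → ℕ→ℚ (suc n) * term i)
    ≡⟨ sumTo-cong (suc n) split ⟩
  sumTo (suc n) (λ i → ℕ→ℚ i * term i + ℕ→ℚ (suc n ∸ i) * term i)
    ≡⟨ sumTo-distrib-+ (suc n) (λ i → ℕ→ℚ i * term i) (λ i → ℕ→ℚ (suc n ∸ i) * term i) ⟩
  sumTo (suc n) (λ i → ℕ→ℚ i * term i) + sumTo (suc n) (λ i → ℕ→ℚ (suc n ∸ i) * term i)
    ≡⟨ cong₂ _+_ left right ⟩
  (derivS f ⊛ g) n + (f ⊛ derivS g) n ∎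
  where
  open ≡-Reasoning
  term : ℕ → ℚ
  term i = f i * g (suc n ∸ i)
  split : ∀ i → i ≤ suc n → ℕ→ℚ (suc n) * term i ≡ ℕ→ℚ i * term i + ℕ→ℚ (suc n ∸ i) * term i
  split i i≤ = trans (cong (λ m → ℕ→ℚ m * term i) (sym (ℕₚ.m+[n∸m]≡n i≤)))
    (trans (cong (_* term i) (ℕ→ℚ-+ i (suc n ∸ i))) (ℚ.*-distribʳ-+ (term i) (ℕ→ℚ i) (ℕ→ℚ (suc n ∸ i))))
  left : sumTo (suc n) (λ i → ℕ→ℚ i * term i) ≡ (derivS f ⊛ g) n
  left = begin
    sumTo (suc n) (λ i → ℕ→ℚ i * term i)
      ≡⟨ sumTo-suc n (λ i → ℕ→ℚ i * term i) ⟩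
    0ℚ * term 0 + sumTo n (λ i → ℕ→ℚ (suc i) * term (suc i))
      ≡⟨ cong (_+ sumTo n (λ i → ℕ→ℚ (suc i) * term (suc i))) (ℚ.*-zeroˡ (term 0)) ⟩
    0ℚ + sumTo n (λ i → ℕ→ℚ (suc i) * term (suc i))
      ≡⟨ ℚ.+-identityˡ (sumTo n (λ i → ℕ→ℚ (suc i) * term (suc i))) ⟩
    sumTo n (λ i → ℕ→ℚ (suc i) * term (suc i))
      ≡⟨ sumTo-ext n (λ i → ℚ.*-assoc (ℕ→ℚ (suc i)) (f (suc i)) (g (n ∸ i))) ⟨
    (derivS f ⊛ g) n ∎
  right : sumTo (suc n) (λ i → ℕ→ℚ (suc n ∸ i) * term i) ≡ (f ⊛ derivS g) n
  right = begin
    sumTo n (λ i → ℕ→ℚ (suc n ∸ i) * term i) + ℕ→ℚ (suc n ∸ suc n) * term (suc n)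
      ≡⟨ cong (_+_ (sumTo n (λ i → ℕ→ℚ (suc n ∸ i) * term i)))
           (trans (cong (λ m → ℕ→ℚ m * term (suc n)) (ℕₚ.n∸n≡0 n)) (ℚ.*-zeroˡ (term (suc n)))) ⟩
    sumTo n (λ i → ℕ→ℚ (suc n ∸ i) * term i) + 0ℚ
      ≡⟨ ℚ.+-identityʳ (sumTo n (λ i → ℕ→ℚ (suc n ∸ i) * term i)) ⟩
    sumTo n (λ i → ℕ→ℚ (suc n ∸ i) * term i)
      ≡⟨ sumTo-cong n (λ i i≤n → trans
           (cong (λ m → ℕ→ℚ m * (f i * g m)) (ℕₚ.+-∸-assoc 1 i≤n))
           (x*[y*z]≡y*[x*z] (ℕ→ℚ (suc (n ∸ i))) (f i) (g (suc (n ∸ i))))) ⟩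
    (f ⊛ derivS g) n ∎

derivS-expS : ∀ a → derivS (expS a) ≋ (λ n → a * expS a n)
derivS-expS a n = begin
  ℕ→ℚ (suc n) * ((a * a ^ℚ n) * suc n !⁻¹)  ≡⟨ rearrange (ℕ→ℚ (suc n)) a (a ^ℚ n) (suc n !⁻¹) ⟩
  a * (a ^ℚ n * (ℕ→ℚ (suc n) * suc n !⁻¹))  ≡⟨ cong (λ x → a * (a ^ℚ n * x)) (suc-*-suc!⁻¹ n) ⟩
  a * (a ^ℚ n * n !⁻¹)                       ∎
  where
  open ≡-Reasoning
  rearrange : ∀ m a p i → m * ((a * p) * i) ≡ a * (p * (m * i))
  rearrange = solve-∀ ℚ-ring

-- Both sides solve D y = (a + b) y with constant term 1.
expS-+ : ∀ a b → (expS a ⊛ expS b) ≋ expS (a + b)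
expS-+ a b zero    = refl
expS-+ a b (suc n) = *-cancelˡ-ℕ→ℚ (suc n) (begin
  derivS (expS a ⊛ expS b) n
    ≡⟨ derivS-⊛ (expS a) (expS b) n ⟩
  (derivS (expS a) ⊛ expS b) n + (expS a ⊛ derivS (expS b)) n
    ≡⟨ cong₂ _+_ (⊛-congʳ (expS b) (derivS-expS a) n) (⊛-congˡ (expS a) (derivS-expS b) n) ⟩
  ((λ m → a * expS a m) ⊛ expS b) n + (expS a ⊛ (λ m → b * expS b m)) n
    ≡⟨ cong₂ _+_ (⊛-scaleˡ (expS a) (expS b) a n) (⊛-scaleʳ (expS a) (expS b) b n) ⟩
  a * (expS a ⊛ expS b) n + b * (expS a ⊛ expS b) n
    ≡⟨ ℚ.*-distribʳ-+ ((expS a ⊛ expS b) n) a b ⟨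
  (a + b) * (expS a ⊛ expS b) n
    ≡⟨ cong ((a + b) *_) (expS-+ a b n) ⟩
  (a + b) * expS (a + b) n
    ≡⟨ derivS-expS (a + b) n ⟨
  derivS (expS (a + b)) n ∎)
  where open ≡-Reasoning

expS-0 : expS 0ℚ ≋ oneS
expS-0 zero    = refl
expS-0 (suc n) = trans (cong (_* suc n !⁻¹) (ℚ.*-zeroˡ (0ℚ ^ℚ n))) (ℚ.*-zeroˡ (suc n !⁻¹))

-- Binomial expansion of ((e^t + 1)/2)^r

expBinomialSum : ℕ → PS
expBinomialSum r n = sumTo r (λ j → ℕ→ℚ (r C j) * expS (ℕ→ℚ j) n)

expBinomialSum-suc : ∀ r →
  expBinomialSum (suc r) ≋ (λ n → (expS 1ℚ ⊛ expBinomialSum r) n + expBinomialSum r n)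
expBinomialSum-suc r n = begin
  expBinomialSum (suc r) n
    ≡⟨ sumTo-pascal r (λ j → expS (ℕ→ℚ j) n) ⟩
  sumTo r (λ j → ℕ→ℚ (r C j) * expS (ℕ→ℚ (suc j)) n) + expBinomialSum r n
    ≡⟨ cong (_+ expBinomialSum r n) (sumTo-ext r (λ j →
         cong (λ x → ℕ→ℚ (r C j) * x)
           (trans (expS-+ 1ℚ (ℕ→ℚ j) n) (cong (λ a → expS a n) (sym (ℕ→ℚ-+ 1 j)))))) ⟨
  sumTo r (λ j → ℕ→ℚ (r C j) * (expS 1ℚ ⊛ expS (ℕ→ℚ j)) n) + expBinomialSum r n
    ≡⟨ cong (_+ expBinomialSum r n)
         (⊛-sumʳ (expS 1ℚ) r (λ j → ℕ→ℚ (r C j)) (λ j → expS (ℕ→ℚ j)) n) ⟨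
  (expS 1ℚ ⊛ expBinomialSum r) n + expBinomialSum r n ∎
  where open ≡-Reasoning

halfExpPlusOne-⊛ : ∀ f → (halfExpPlusOne ⊛ f) ≋ (λ n → ((expS 1ℚ ⊛ f) n + f n) * ½)
halfExpPlusOne-⊛ f n = begin
  sumTo n (λ i → ((expS 1ℚ i + oneS i) * ½) * f (n ∸ i))
    ≡⟨ sumTo-ext n (λ i → rearrange (expS 1ℚ i) (oneS i) ½ (f (n ∸ i))) ⟩
  sumTo n (λ i → (expS 1ℚ i * f (n ∸ i) + oneS i * f (n ∸ i)) * ½)
    ≡⟨ *-distribʳ-sumTo n ½ (λ i → expS 1ℚ i * f (n ∸ i) + oneS i * f (n ∸ i)) ⟨
  sumTo n (λ i → expS 1ℚ i * f (n ∸ i) + oneS i * f (n ∸ i)) * ½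
    ≡⟨ cong (_* ½) (sumTo-distrib-+ n (λ i → expS 1ℚ i * f (n ∸ i)) (λ i → oneS i * f (n ∸ i))) ⟩
  ((expS 1ℚ ⊛ f) n + (oneS ⊛ f) n) * ½
    ≡⟨ cong (λ x → ((expS 1ℚ ⊛ f) n + x) * ½) (⊛-identityˡ f n) ⟩
  ((expS 1ℚ ⊛ f) n + f n) * ½ ∎
  where
  open ≡-Reasoning
  rearrange : ∀ e o h y → ((e + o) * h) * y ≡ (e * y + o * y) * h
  rearrange = solve-∀ ℚ-ring

powS-halfExpPlusOne : ∀ r → powS halfExpPlusOne r ≋ (λ n → (½ ^ℚ r) * expBinomialSum r n)
powS-halfExpPlusOne zero    n = sym (trans (ℚ.*-identityˡ (1ℚ * expS 0ℚ n))
  (trans (ℚ.*-identityˡ (expS 0ℚ n)) (expS-0 n)))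
powS-halfExpPlusOne (suc r) n = begin
  (halfExpPlusOne ⊛ powS halfExpPlusOne r) n
    ≡⟨ ⊛-congˡ halfExpPlusOne (powS-halfExpPlusOne r) n ⟩
  (halfExpPlusOne ⊛ (λ m → (½ ^ℚ r) * S m)) n
    ≡⟨ ⊛-scaleʳ halfExpPlusOne S (½ ^ℚ r) n ⟩
  (½ ^ℚ r) * (halfExpPlusOne ⊛ S) n
    ≡⟨ cong ((½ ^ℚ r) *_) (halfExpPlusOne-⊛ S n) ⟩
  (½ ^ℚ r) * (((expS 1ℚ ⊛ S) n + S n) * ½)
    ≡⟨ cong (λ x → (½ ^ℚ r) * (x * ½)) (expBinomialSum-suc r n) ⟨
  (½ ^ℚ r) * (expBinomialSum (suc r) n * ½)
    ≡⟨ rearrange (½ ^ℚ r) (expBinomialSum (suc r) n) ½ ⟩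
  (½ * (½ ^ℚ r)) * expBinomialSum (suc r) n ∎
  where
  open ≡-Reasoning
  S = expBinomialSum r
  rearrange : ∀ p s h → p * (s * h) ≡ (h * p) * s
  rearrange = solve-∀ ℚ-ring

C*[!*!]≡! : ∀ n m → m ≤ n → (n C m) ℕ.* (m ! ℕ.* (n ∸ m) !) ≡ n !
C*[!*!]≡! n m m≤n = trans (cong (ℕ._* (m ! ℕ.* (n ∸ m) !)) (nCk≡n!/k![n-k]! m≤n))
  (m/n*n≡m {{m ℕₚ.!* (n ∸ m) !≢0}} (k![n∸k]!∣n! m≤n))

!-*-⊛ : ∀ f g n → ℕ→ℚ (n !) * (f ⊛ g) n
  ≡ sumTo n (λ m → ℕ→ℚ (n C m) * ((ℕ→ℚ (m !) * f m) * (ℕ→ℚ ((n ∸ m) !) * g (n ∸ m))))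
!-*-⊛ f g n = trans (*-distribˡ-sumTo n (ℕ→ℚ (n !)) (λ m → f m * g (n ∸ m))) (sumTo-cong n term)
  where
  open ≡-Reasoning
  term : ∀ m → m ≤ n → ℕ→ℚ (n !) * (f m * g (n ∸ m))
    ≡ ℕ→ℚ (n C m) * ((ℕ→ℚ (m !) * f m) * (ℕ→ℚ ((n ∸ m) !) * g (n ∸ m)))
  term m m≤n = begin
    ℕ→ℚ (n !) * (f m * g (n ∸ m))
      ≡⟨ cong (λ k → ℕ→ℚ k * (f m * g (n ∸ m))) (C*[!*!]≡! n m m≤n) ⟨
    ℕ→ℚ ((n C m) ℕ.* (m ! ℕ.* (n ∸ m) !)) * (f m * g (n ∸ m))
      ≡⟨ cong (_* (f m * g (n ∸ m))) (trans (ℕ→ℚ-* (n C m) (m ! ℕ.* (n ∸ m) !))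
           (cong (ℕ→ℚ (n C m) *_) (ℕ→ℚ-* (m !) ((n ∸ m) !)))) ⟩
    (ℕ→ℚ (n C m) * (ℕ→ℚ (m !) * ℕ→ℚ ((n ∸ m) !))) * (f m * g (n ∸ m))
      ≡⟨ rearrange (ℕ→ℚ (n C m)) (ℕ→ℚ (m !)) (ℕ→ℚ ((n ∸ m) !)) (f m) (g (n ∸ m)) ⟩
    ℕ→ℚ (n C m) * ((ℕ→ℚ (m !) * f m) * (ℕ→ℚ ((n ∸ m) !) * g (n ∸ m))) ∎
    where
    rearrange : ∀ c a b x y → (c * (a * b)) * (x * y) ≡ c * ((a * x) * (b * y))
    rearrange = solve-∀ ℚ-ring

!-*-⊛-powS-halfExpPlusOne : ∀ f r p → ℕ→ℚ (p !) * (f ⊛ powS halfExpPlusOne r) p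
  ≡ (½ ^ℚ r) * sumTo r (λ j → ℕ→ℚ (r C j) * (ℕ→ℚ (p !) * (f ⊛ expS (ℕ→ℚ j)) p))
!-*-⊛-powS-halfExpPlusOne f r p = begin
  ℕ→ℚ (p !) * (f ⊛ powS halfExpPlusOne r) p
    ≡⟨ cong (ℕ→ℚ (p !) *_) (⊛-congˡ f (powS-halfExpPlusOne r) p) ⟩
  ℕ→ℚ (p !) * (f ⊛ (λ m → (½ ^ℚ r) * expBinomialSum r m)) p
    ≡⟨ cong (ℕ→ℚ (p !) *_) (⊛-scaleʳ f (expBinomialSum r) (½ ^ℚ r) p) ⟩
  ℕ→ℚ (p !) * ((½ ^ℚ r) * (f ⊛ expBinomialSum r) p)
    ≡⟨ cong (λ x → ℕ→ℚ (p !) * ((½ ^ℚ r) * x))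
         (⊛-sumʳ f r (λ j → ℕ→ℚ (r C j)) (λ j → expS (ℕ→ℚ j)) p) ⟩
  ℕ→ℚ (p !) * ((½ ^ℚ r) * sumTo r (λ j → ℕ→ℚ (r C j) * (f ⊛ expS (ℕ→ℚ j)) p))
    ≡⟨ x*[y*z]≡y*[x*z] (ℕ→ℚ (p !)) (½ ^ℚ r) _ ⟩
  (½ ^ℚ r) * (ℕ→ℚ (p !) * sumTo r (λ j → ℕ→ℚ (r C j) * (f ⊛ expS (ℕ→ℚ j)) p))
    ≡⟨ cong ((½ ^ℚ r) *_) (trans (*-distribˡ-sumTo r (ℕ→ℚ (p !)) _) (sumTo-ext r (λ j →
         x*[y*z]≡y*[x*z] (ℕ→ℚ (p !)) (ℕ→ℚ (r C j)) ((f ⊛ expS (ℕ→ℚ j)) p)))) ⟩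
  (½ ^ℚ r) * sumTo r (λ j → ℕ→ℚ (r C j) * (ℕ→ℚ (p !) * (f ⊛ expS (ℕ→ℚ j)) p)) ∎
  where open ≡-Reasoning

theorem5 : (k : ℤ) (r n : ℕ) (x : ℚ) →
    polyBernoulli k n x ≡
      (½ ^ℚ r) * sumTo n (λ m →
        (ℕ→ℚ (n C m) * sumTo r (λ j → ℕ→ℚ (r C j) * polyBernoulli k (n ∸ m) (ℕ→ℚ j)))
        * eulerPoly r m x)
theorem5 k r n x = begin
  ℕ→ℚ (n !) * (G ⊛ E) n
    ≡⟨ cong (ℕ→ℚ (n !) *_) (⊛-insert-inverse {H} {P} H⊛P≋1 G E n) ⟩
  ℕ→ℚ (n !) * ((P ⊛ E) ⊛ (G ⊛ H)) n
    ≡⟨ !-*-⊛ (P ⊛ E) (G ⊛ H) n ⟩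
  sumTo n (λ m → ℕ→ℚ (n C m) * (eulerPoly r m x * (ℕ→ℚ ((n ∸ m) !) * (G ⊛ H) (n ∸ m))))
    ≡⟨ sumTo-ext n (λ m → cong (λ y → ℕ→ℚ (n C m) * (eulerPoly r m x * y))
         (!-*-⊛-powS-halfExpPlusOne G r (n ∸ m))) ⟩
  sumTo n (λ m → ℕ→ℚ (n C m) * (eulerPoly r m x * ((½ ^ℚ r) * B (n ∸ m))))
    ≡⟨ sumTo-ext n (λ m → rearrange (ℕ→ℚ (n C m)) (eulerPoly r m x) (½ ^ℚ r) (B (n ∸ m))) ⟩
  sumTo n (λ m → (½ ^ℚ r) * ((ℕ→ℚ (n C m) * B (n ∸ m)) * eulerPoly r m x))
    ≡⟨ *-distribˡ-sumTo n (½ ^ℚ r) (λ m → (ℕ→ℚ (n C m) * B (n ∸ m)) * eulerPoly r m x) ⟨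
  (½ ^ℚ r) * sumTo n (λ m → (ℕ→ℚ (n C m) * B (n ∸ m)) * eulerPoly r m x) ∎
  where
  open ≡-Reasoning
  G = polyBernGen k
  E = expS x
  H = powS halfExpPlusOne r
  P = powS (inv1 halfExpPlusOne) r
  B : ℕ → ℚ
  B p = sumTo r (λ j → ℕ→ℚ (r C j) * polyBernoulli k p (ℕ→ℚ j))
  H⊛P≋1 : (H ⊛ P) ≋ oneS
  H⊛P≋1 = powS-inverse (⊛-inv1 halfExpPlusOne refl) r
  rearrange : ∀ c e h b → c * (e * (h * b)) ≡ h * ((c * b) * e)
  rearrange = solve-∀ ℚ-ring
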